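{- Let $U$ be a set and $\mathcal R$ a set of partial bijections on $U$ that is closed under composition and inverse. Then the theory of the structure $(U,\mathcal R)$ admits quantifier elimination: for every first-order formula $A$ of its language there is a quantifier-free formula $B$ of that language such that $A\leftrightarrow B$ holds in $(U,\mathcal R)$ for all values of the free variables.
   Context: A partial bijection on $U$ is a relation $R\subseteq U\times U$ which is a one-to-one correspondence between a subset of $U$ and a subset of $U$ (i.e. $R(x,y)\wedge R(x,y')\Rightarrow y=y'$ and $R(x,y)\wedge R(x',y)\Rightarrow x=x'$). For relations, $R^{ -1}=\{(y,x)\mid (x,y)\in R\}$ and $R\circ S=\{(x,z)\mid\exists y.\,(x,y)\in S\wedge(y,z)\in R\}$. $\mathcal R$ is closed under composition and inverse if $R,S\in\mathcal R$ implies $R^{ -1}\in\mathcal R$ and $R\circ S\in\mathcal R$. The structure $(U,\mathcal R)$ has universe $U$, a binary predicate symbol for each $R\in\mathcal R$ (interpreted as $R$), a constant symbol for each element $u\in U$ (interpreted as $u$), and equality. -}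

module Defs where

open import Level using (0ℓ)
open import Data.Nat using (ℕ; suc)
open import Data.Fin using (Fin; zero; suc)
open import Data.Product using (Σ; _×_; _,_; ∃)
open import Data.Sum using (_⊎_)
open import Data.Empty using (⊥)
open import Data.Unit using (⊤)
open import Relation.Nullary using (¬_)
open import Relation.Binary.PropositionalEquality using (_≡_)
open import Function.Bundles using (_⇔_)

BinRel : Set → Set₁
BinRel U = U → U → Set

IsPartialBijection : {U : Set} → BinRel U → Set
IsPartialBijection R =
  (∀ {x y y'} → R x y → R x y' → y ≡ y') ×
  (∀ {x x' y} → R x y → R x' y → x ≡ x')

inv : {U : Set} → BinRel U → BinRel U
inv R y x = R x y

_∘ʳ_ : {U : Set} → BinRel U → BinRel U → BinRel U
(R ∘ʳ S) x z = ∃ λ y → S x y × R y z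

_≐_ : {U : Set} → BinRel U → BinRel U → Set
R ≐ S = ∀ x y → R x y ⇔ S x y

-- The set ℛ is given as a family Rel : I → BinRel U (I indexes the
-- predicate symbols). Closure under inverse and composition:
ClosedInvComp : {U I : Set} → (I → BinRel U) → Set
ClosedInvComp {I = I} Rel =
  (∀ i → ∃ λ k → Rel k ≐ inv (Rel i)) ×
  (∀ i j → ∃ λ k → Rel k ≐ (Rel i ∘ʳ Rel j))

-- Terms of the language of (U, ℛ) with n free variables (de Bruijn):
-- variables and a constant symbol for each u ∈ U.
data Term (U : Set) (n : ℕ) : Set where
  var   : Fin n → Term U n
  const : U → Term U n

data Formula (U I : Set) : ℕ → Set where
  rel  : ∀ {n} → I → Term U n → Term U n → Formula U I n
  eq   : ∀ {n} → Term U n → Term U n → Formula U I n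
  tt ff : ∀ {n} → Formula U I n
  ¬f   : ∀ {n} → Formula U I n → Formula U I n
  _∧f_ _∨f_ _⇒f_ : ∀ {n} → Formula U I n → Formula U I n → Formula U I n
  ∀f ∃f : ∀ {n} → Formula U I (suc n) → Formula U I n

data IsQF {U I : Set} : ∀ {n} → Formula U I n → Set where
  rel  : ∀ {n} i (s t : Term U n) → IsQF (rel i s t)
  eq   : ∀ {n} (s t : Term U n) → IsQF (eq {I = I} s t)
  tt   : ∀ {n} → IsQF (tt {n = n})
  ff   : ∀ {n} → IsQF (ff {n = n})
  ¬f   : ∀ {n} {A : Formula U I n} → IsQF A → IsQF (¬f A)
  _∧f_ : ∀ {n} {A B : Formula U I n} → IsQF A → IsQF B → IsQF (A ∧f B)
  _∨f_ : ∀ {n} {A B : Formula U I n} → IsQF A → IsQF B → IsQF (A ∨f B)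
  _⇒f_ : ∀ {n} {A B : Formula U I n} → IsQF A → IsQF B → IsQF (A ⇒f B)

extend : {U : Set} {n : ℕ} → (Fin n → U) → U → Fin (suc n) → U
extend ρ u zero    = u
extend ρ u (suc i) = ρ i

evalT : {U : Set} {n : ℕ} → (Fin n → U) → Term U n → U
evalT ρ (var x)   = ρ x
evalT ρ (const u) = u

-- Tarski satisfaction in the structure (U, ℛ) (read with excluded middle
-- assumed as a hypothesis of the theorem, this is the classical semantics).
Sat : {U I : Set} → (I → BinRel U) → {n : ℕ} → (Fin n → U) → Formula U I n → Set
Sat Rel ρ (rel i s t) = Rel i (evalT ρ s) (evalT ρ t)
Sat Rel ρ (eq s t)    = evalT ρ s ≡ evalT ρ t
Sat Rel ρ tt          = ⊤
Sat Rel ρ ff          = ⊥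
Sat Rel ρ (¬f A)      = ¬ Sat Rel ρ A
Sat Rel ρ (A ∧f B)    = Sat Rel ρ A × Sat Rel ρ B
Sat Rel ρ (A ∨f B)    = Sat Rel ρ A ⊎ Sat Rel ρ B
Sat Rel ρ (A ⇒f B)    = Sat Rel ρ A → Sat Rel ρ B
Sat Rel ρ (∀f A)      = (u : _) → Sat Rel (extend ρ u) A
Sat Rel ρ (∃f A)      = Σ _ λ u → Sat Rel (extend ρ u) A

-- It suffices to eliminate ∃y from ∃y.B with B quantifier-free. Because the
-- relations are partial bijections, an atom R(y,t), R(t,y) or y = t pins y
-- down to at most one value definable from t: t itself or its image under R or R⁻¹.
-- So either y is one of finitely many such candidates, each of which can be
-- substituted into B (composition and inversion rewrite the atoms), or every
-- such atom is false and B only depends on which relations hold on the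
-- diagonal R(y,y). In that case y matters only through its diagonal profile,
-- and there are finitely many profiles. A profile class either contains
-- points outside the candidates for every valuation — then one representative
-- serves as witness — or it is covered by the candidates of one fixed
-- valuation, hence finite, and its points can be named by constants.
module Submission where

open import Defs
open import Level using (0ℓ)
open import Data.Nat using (ℕ; suc)
open import Data.Fin using (Fin; zero; suc)
open import Data.Product using (Σ; _×_; _,_; proj₁; proj₂; ∃)
open import Data.Product.Function.NonDependent.Propositional using (_×-⇔_)
open import Data.Product.Function.Dependent.Propositional using (Σ-⇔)
open import Data.Sum using (_⊎_; inj₁; inj₂)
open import Data.Sum.Function.Propositional using (_⊎-⇔_)
open import Data.Empty using (⊥-elim)
open import Data.Unit using (⊤; tt)
open import Data.List using (List; []; _∷_; _++_; map; concatMap)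
open import Data.List.Relation.Unary.All as All using (All; []; _∷_)
import Data.List.Relation.Unary.All.Properties as Allₚ
open import Data.List.Relation.Unary.Any as Any using (Any; here; there)
import Data.List.Relation.Unary.Any.Properties as Anyₚ
open import Relation.Nullary using (¬_; yes; no)
open import Relation.Binary.Structures using (IsEquivalence)
open import Relation.Binary.PropositionalEquality
  using (_≡_; refl; sym; subst; cong; cong₂)
open import Function using (_∘_)
open import Function.Bundles using (_⇔_; mk⇔; Equivalence)
open import Function.Construct.Identity using (↠-id)
open import Function.Properties.Equivalence using (⇔-isEquivalence)
open import Function.Related.TypeIsomorphisms using (¬-cong-⇔; →-cong-⇔)
open import Axiom.ExcludedMiddle using (ExcludedMiddle)
open import Axiom.DoubleNegationElimination using (em⇒dne)

open Equivalence using (to; from)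
module ⇔ = IsEquivalence (⇔-isEquivalence {ℓ = 0ℓ})

module Classical (em : ExcludedMiddle 0ℓ) where

  ∀⇔¬∃¬ : {A : Set} {P : A → Set} → ((a : A) → P a) ⇔ (¬ Σ A λ a → ¬ P a)
  ∀⇔¬∃¬ = mk⇔ (λ ∀P (a , ¬Pa) → ¬Pa (∀P a))
               (λ ¬∃¬P a → em⇒dne em (λ ¬Pa → ¬∃¬P (a , ¬Pa)))

  witness : {A : Set} (P : A → Set) → List A
  witness {A} P with em {∃ P}
  ... | yes (a , _) = a ∷ []
  ... | no _        = []

  witness-complete : {A : Set} {P : A → Set} {a : A} → P a → Any P (witness P)
  witness-complete {P = P} {a} Pa with em {∃ P}
  ... | yes (_ , Pb) = here Pb
  ... | no ¬∃P       = ⊥-elim (¬∃P (a , Pa))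

  module Profiles {J A : Set} (P : J → A → Set) where

    SameProfile : List J → A → A → Set
    SameProfile js a b = All (λ j → P j a ⇔ P j b) js

    sameProfile-trans : ∀ {js a b c} →
      SameProfile js a b → SameProfile js b c → SameProfile js a c
    sameProfile-trans []       []       = []
    sameProfile-trans (e ∷ es) (f ∷ fs) = ⇔.trans e f ∷ sameProfile-trans es fs

    sameProfile-sym : ∀ {js a b} → SameProfile js a b → SameProfile js b a
    sameProfile-sym = All.map ⇔.sym

    representatives : (js : List J) → Σ (List A) λ rs → ∀ a → Any (SameProfile js a) rs
    representatives [] =
      witness (λ _ → ⊤) , λ a → Any.map (λ _ → []) (witness-complete {P = λ _ → ⊤} {a} tt)
    representatives (j ∷ js) = concatMap refine rs , covered
      where
      rs = proj₁ (representatives js)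

      Refines : A → (A → Set) → A → Set
      Refines r Q b = SameProfile js b r × Q b

      refine : A → List A
      refine r = witness (Refines r (P j)) ++ witness (Refines r (¬_ ∘ P j))

      covered : ∀ a → Any (SameProfile (j ∷ js) a) (concatMap refine rs)
      covered a = Anyₚ.concatMap⁺ refine
        (Any.map (λ {r} a~r → refine-covers r a~r) (proj₂ (representatives js) a))
        where
        extend-profile : ∀ {r b} → SameProfile js a r → P j a ⇔ P j b →
          SameProfile js b r → SameProfile (j ∷ js) a b
        extend-profile a~r e b~r = e ∷ sameProfile-trans a~r (sameProfile-sym b~r)

        refine-covers : ∀ r → SameProfile js a r → Any (SameProfile (j ∷ js) a) (refine r)
        refine-covers r a~r with em {P j a}
        ... | yes Pja = Anyₚ.++⁺ˡ (Any.map
              (λ (b~r , Pjb) → extend-profile a~r (mk⇔ (λ _ → Pjb) (λ _ → Pja)) b~r)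
              (witness-complete (a~r , Pja)))
        ... | no ¬Pja = Anyₚ.++⁺ʳ (witness (Refines r (P j))) (Any.map
              (λ (b~r , ¬Pjb) → extend-profile a~r (mk⇔ (⊥-elim ∘ ¬Pja) (⊥-elim ∘ ¬Pjb)) b~r)
              (witness-complete (a~r , ¬Pja)))

module _ {U : Set} where

  weaken : ∀ {n} → Term U n → Term U (suc n)
  weaken (var i)   = var (suc i)
  weaken (const c) = const c

  evalT-weaken : ∀ {n} (ρ : Fin n → U) u (t : Term U n) →
    evalT (extend ρ u) (weaken t) ≡ evalT ρ t
  evalT-weaken ρ u (var i)   = refl
  evalT-weaken ρ u (const c) = refl

  data Var₀View {n : ℕ} : Term U (suc n) → Set where
    var₀     : Var₀View (var zero)
    weakened : (t : Term U n) → Var₀View (weaken t)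

  var₀View : ∀ {n} (s : Term U (suc n)) → Var₀View s
  var₀View (var zero)    = var₀
  var₀View (var (suc i)) = weakened (var i)
  var₀View (const c)     = weakened (const c)

  instantiate : ∀ {n} → Term U n → Term U (suc n) → Term U n
  instantiate t (var zero)    = t
  instantiate t (var (suc i)) = var i
  instantiate t (const c)     = const c

  evalT-instantiate : ∀ {n} (ρ : Fin n → U) (t : Term U n) s →
    evalT ρ (instantiate t s) ≡ evalT (extend ρ (evalT ρ t)) s
  evalT-instantiate ρ t (var zero)    = refl
  evalT-instantiate ρ t (var (suc i)) = refl
  evalT-instantiate ρ t (const c)     = refl

data Atom (U I : Set) (n : ℕ) : Set where
  rel : I → Term U n → Term U n → Atom U I n
  eq  : Term U n → Term U n → Atom U I n

module _ {U I : Set} where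

  atomFormula : ∀ {n} → Atom U I n → Formula U I n
  atomFormula (rel i s t) = rel i s t
  atomFormula (eq s t)    = eq s t

  atomFormula-qf : ∀ {n} (a : Atom U I n) → IsQF (atomFormula a)
  atomFormula-qf (rel i s t) = rel i s t
  atomFormula-qf (eq s t)    = eq s t

  atoms : ∀ {n} {B : Formula U I n} → IsQF B → List (Atom U I n)
  atoms (rel i s t) = rel i s t ∷ []
  atoms (eq s t)    = eq s t ∷ []
  atoms tt          = []
  atoms ff          = []
  atoms (¬f q)      = atoms q
  atoms (q ∧f q′)   = atoms q ++ atoms q′
  atoms (q ∨f q′)   = atoms q ++ atoms q′
  atoms (q ⇒f q′)   = atoms q ++ atoms q′

  replaceAtoms : ∀ {m k} → (Atom U I m → Formula U I k) →
    {B : Formula U I m} → IsQF B → Formula U I k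
  replaceAtoms f (rel i s t) = f (rel i s t)
  replaceAtoms f (eq s t)    = f (eq s t)
  replaceAtoms f tt          = tt
  replaceAtoms f ff          = ff
  replaceAtoms f (¬f q)      = ¬f (replaceAtoms f q)
  replaceAtoms f (q ∧f q′)   = replaceAtoms f q ∧f replaceAtoms f q′
  replaceAtoms f (q ∨f q′)   = replaceAtoms f q ∨f replaceAtoms f q′
  replaceAtoms f (q ⇒f q′)   = replaceAtoms f q ⇒f replaceAtoms f q′

  replaceAtoms-qf : ∀ {m k} {f : Atom U I m → Formula U I k} → (∀ a → IsQF (f a)) →
    {B : Formula U I m} (q : IsQF B) → IsQF (replaceAtoms f q)
  replaceAtoms-qf f-qf (rel i s t) = f-qf _
  replaceAtoms-qf f-qf (eq s t)    = f-qf _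
  replaceAtoms-qf f-qf tt          = tt
  replaceAtoms-qf f-qf ff          = ff
  replaceAtoms-qf f-qf (¬f q)      = ¬f (replaceAtoms-qf f-qf q)
  replaceAtoms-qf f-qf (q ∧f q′)   = replaceAtoms-qf f-qf q ∧f replaceAtoms-qf f-qf q′
  replaceAtoms-qf f-qf (q ∨f q′)   = replaceAtoms-qf f-qf q ∨f replaceAtoms-qf f-qf q′
  replaceAtoms-qf f-qf (q ⇒f q′)   = replaceAtoms-qf f-qf q ⇒f replaceAtoms-qf f-qf q′

  replaceAtoms-atomFormula : ∀ {m} {B : Formula U I m} (q : IsQF B) →
    replaceAtoms atomFormula q ≡ B
  replaceAtoms-atomFormula (rel i s t) = refl
  replaceAtoms-atomFormula (eq s t)    = refl
  replaceAtoms-atomFormula tt          = refl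
  replaceAtoms-atomFormula ff          = refl
  replaceAtoms-atomFormula (¬f q)      = cong ¬f (replaceAtoms-atomFormula q)
  replaceAtoms-atomFormula (q ∧f q′)   =
    cong₂ _∧f_ (replaceAtoms-atomFormula q) (replaceAtoms-atomFormula q′)
  replaceAtoms-atomFormula (q ∨f q′)   =
    cong₂ _∨f_ (replaceAtoms-atomFormula q) (replaceAtoms-atomFormula q′)
  replaceAtoms-atomFormula (q ⇒f q′)   =
    cong₂ _⇒f_ (replaceAtoms-atomFormula q) (replaceAtoms-atomFormula q′)

  instantiateAtom : ∀ {n} → Term U n → Atom U I (suc n) → Atom U I n
  instantiateAtom t (rel i s s′) = rel i (instantiate t s) (instantiate t s′)
  instantiateAtom t (eq s s′)    = eq (instantiate t s) (instantiate t s′)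

  module _ (Rel : I → BinRel U) where

    replaceAtoms-cong : ∀ {m k l} {f : Atom U I m → Formula U I k}
      {g : Atom U I m → Formula U I l} {ρ : Fin k → U} {ρ′ : Fin l → U}
      {B : Formula U I m} (q : IsQF B) →
      All (λ a → Sat Rel ρ (f a) ⇔ Sat Rel ρ′ (g a)) (atoms q) →
      Sat Rel ρ (replaceAtoms f q) ⇔ Sat Rel ρ′ (replaceAtoms g q)
    replaceAtoms-cong (rel i s t) (e ∷ []) = e
    replaceAtoms-cong (eq s t)    (e ∷ []) = e
    replaceAtoms-cong tt          _        = ⇔.refl
    replaceAtoms-cong ff          _        = ⇔.refl
    replaceAtoms-cong (¬f q)      es       = ¬-cong-⇔ (replaceAtoms-cong q es)
    replaceAtoms-cong (q ∧f q′)   es       =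
      replaceAtoms-cong q (Allₚ.++⁻ˡ (atoms q) es)
        ×-⇔ replaceAtoms-cong q′ (Allₚ.++⁻ʳ (atoms q) es)
    replaceAtoms-cong (q ∨f q′)   es       =
      replaceAtoms-cong q (Allₚ.++⁻ˡ (atoms q) es)
        ⊎-⇔ replaceAtoms-cong q′ (Allₚ.++⁻ʳ (atoms q) es)
    replaceAtoms-cong (q ⇒f q′)   es       =
      →-cong-⇔ (replaceAtoms-cong q (Allₚ.++⁻ˡ (atoms q) es))
               (replaceAtoms-cong q′ (Allₚ.++⁻ʳ (atoms q) es))

    replaceAtoms-sound : ∀ {m k} {f : Atom U I m → Formula U I k}
      {ρ : Fin k → U} {ρ′ : Fin m → U} {B : Formula U I m} (q : IsQF B) →
      All (λ a → Sat Rel ρ (f a) ⇔ Sat Rel ρ′ (atomFormula a)) (atoms q) →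
      Sat Rel ρ (replaceAtoms f q) ⇔ Sat Rel ρ′ B
    replaceAtoms-sound {ρ = ρ} {ρ′} q es =
      subst (λ C → Sat Rel ρ (replaceAtoms _ q) ⇔ Sat Rel ρ′ C)
            (replaceAtoms-atomFormula q) (replaceAtoms-cong q es)

    instantiateAtom-sound : ∀ {n} (ρ : Fin n → U) (t : Term U n) (a : Atom U I (suc n)) →
      Sat Rel ρ (atomFormula (instantiateAtom t a)) ⇔ Sat Rel (extend ρ (evalT ρ t)) (atomFormula a)
    instantiateAtom-sound ρ t (rel i s s′)
      rewrite evalT-instantiate ρ t s | evalT-instantiate ρ t s′ = ⇔.refl
    instantiateAtom-sound ρ t (eq s s′)
      rewrite evalT-instantiate ρ t s | evalT-instantiate ρ t s′ = ⇔.refl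

    ⋁ : ∀ {n} → List (Formula U I n) → Formula U I n
    ⋁ []       = ff
    ⋁ (φ ∷ φs) = φ ∨f ⋁ φs

    ⋁-qf : ∀ {n} {φs : List (Formula U I n)} → All IsQF φs → IsQF (⋁ φs)
    ⋁-qf []       = ff
    ⋁-qf (q ∷ qs) = q ∨f ⋁-qf qs

    ⋁-sound : ∀ {n} (ρ : Fin n → U) (φs : List (Formula U I n)) →
      Sat Rel ρ (⋁ φs) ⇔ Any (Sat Rel ρ) φs
    ⋁-sound ρ []       = mk⇔ (λ ()) (λ ())
    ⋁-sound ρ (φ ∷ φs) = mk⇔ forward backward
      where
      forward : Sat Rel ρ (⋁ (φ ∷ φs)) → Any (Sat Rel ρ) (φ ∷ φs)
      forward (inj₁ x) = here x
      forward (inj₂ y) = there (to (⋁-sound ρ φs) y)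
      backward : Any (Sat Rel ρ) (φ ∷ φs) → Sat Rel ρ (⋁ (φ ∷ φs))
      backward (here x)  = inj₁ x
      backward (there y) = inj₂ (from (⋁-sound ρ φs) y)

module QuantifierElimination
  (em : ExcludedMiddle 0ℓ) {U I : Set} (Rel : I → BinRel U)
  (isPB : ∀ i → IsPartialBijection (Rel i)) (closed : ClosedInvComp Rel) where

  open Classical em

  F : ℕ → Set
  F = Formula U I

  T : ℕ → Set
  T = Term U

  infix 4 _⊨_
  _⊨_ : ∀ {n} → (Fin n → U) → F n → Set
  _⊨_ = Sat Rel

  _⁻¹ : I → I
  k ⁻¹ = proj₁ (proj₁ closed k)

  inverse-spec : ∀ k x y → Rel (k ⁻¹) x y ⇔ Rel k y x
  inverse-spec k = proj₂ (proj₁ closed k)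

  infixl 7 _∙_
  _∙_ : I → I → I
  i ∙ j = proj₁ (proj₂ closed i j)

  compose-spec : ∀ i j x z → Rel (i ∙ j) x z ⇔ ∃ λ y → Rel j x y × Rel i y z
  compose-spec i j = proj₂ (proj₂ closed i j)

  functional : ∀ k {x y y′} → Rel k x y → Rel k x y′ → y ≡ y′
  functional k = proj₁ (isPB k)

  module _ (k : I) {a y : U} (ky : Rel k a y) where

    image-unique : ∀ {b} → Rel k a b ⇔ (y ≡ b)
    image-unique = mk⇔ (functional k ky) (λ y≡b → subst (Rel k a) y≡b ky)

    ∙-image : ∀ j {b} → Rel (j ∙ k) a b ⇔ Rel j y b
    ∙-image j {b} = mk⇔ forward (λ jyb → from (compose-spec j k a b) (y , ky , jyb))
      where
      forward : Rel (j ∙ k) a b → Rel j y b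
      forward jkab with to (compose-spec j k a b) jkab
      ... | w , kw , jwb = subst (λ z → Rel j z b) (sym (functional k ky kw)) jwb

    ⁻¹∙-image : ∀ j {b} → Rel (k ⁻¹ ∙ j) b a ⇔ Rel j b y
    ⁻¹∙-image j {b} =
      mk⇔ forward (λ jby → from (compose-spec (k ⁻¹) j b a) (y , jby , from (inverse-spec k y a) ky))
      where
      forward : Rel (k ⁻¹ ∙ j) b a → Rel j b y
      forward r with to (compose-spec (k ⁻¹) j b a) r
      ... | w , jbw , k⁻¹wa =
        subst (Rel j b) (sym (functional k ky (to (inverse-spec k w a) k⁻¹wa))) jbw

    conjugate-image : ∀ j → Rel (k ⁻¹ ∙ (j ∙ k)) a a ⇔ Rel j y y
    conjugate-image j = ⇔.trans (⁻¹∙-image (j ∙ k)) (∙-image j)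

  domain-spec : ∀ k a → Rel (k ⁻¹ ∙ k) a a ⇔ ∃ (Rel k a)
  domain-spec k a = mk⇔ forward backward
    where
    forward : Rel (k ⁻¹ ∙ k) a a → ∃ (Rel k a)
    forward r with to (compose-spec (k ⁻¹) k a a) r
    ... | w , kaw , _ = w , kaw
    backward : ∃ (Rel k a) → Rel (k ⁻¹ ∙ k) a a
    backward (w , kaw) = from (compose-spec (k ⁻¹) k a a) (w , kaw , from (inverse-spec k w a) kaw)

  -- The atom with y (variable 0) := the k-image of t, assuming that image exists.
  viaImage : ∀ {m} → I → T m → Atom U I (suc m) → F m
  viaImage k t (rel j s s′) with var₀View s | var₀View s′
  ... | var₀       | var₀        = rel (k ⁻¹ ∙ (j ∙ k)) t t
  ... | var₀       | weakened u  = rel (j ∙ k) t u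
  ... | weakened u | var₀        = rel (k ⁻¹ ∙ j) u t
  ... | weakened u | weakened u′ = rel j u u′
  viaImage k t (eq s s′) with var₀View s | var₀View s′
  ... | var₀       | var₀        = tt
  ... | var₀       | weakened u  = rel k t u
  ... | weakened u | var₀        = rel k t u
  ... | weakened u | weakened u′ = eq u u′

  viaImage-qf : ∀ {m} k (t : T m) a → IsQF (viaImage k t a)
  viaImage-qf k t (rel j s s′) with var₀View s | var₀View s′
  ... | var₀       | var₀        = rel _ _ _
  ... | var₀       | weakened u  = rel _ _ _
  ... | weakened u | var₀        = rel _ _ _
  ... | weakened u | weakened u′ = rel _ _ _
  viaImage-qf k t (eq s s′) with var₀View s | var₀View s′
  ... | var₀       | var₀        = tt
  ... | var₀       | weakened u  = rel _ _ _
  ... | weakened u | var₀        = rel _ _ _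
  ... | weakened u | weakened u′ = eq _ _

  viaImage-sound : ∀ {m} (ρ : Fin m → U) k (t : T m) {y} → Rel k (evalT ρ t) y → ∀ a →
    ρ ⊨ viaImage k t a ⇔ extend ρ y ⊨ atomFormula a
  viaImage-sound ρ k t {y} ky (rel j s s′) with var₀View s | var₀View s′
  ... | var₀       | var₀        = conjugate-image k ky j
  ... | var₀       | weakened u  rewrite evalT-weaken ρ y u = ∙-image k ky j
  ... | weakened u | var₀        rewrite evalT-weaken ρ y u = ⁻¹∙-image k ky j
  ... | weakened u | weakened u′ rewrite evalT-weaken ρ y u | evalT-weaken ρ y u′ = ⇔.refl
  viaImage-sound ρ k t {y} ky (eq s s′) with var₀View s | var₀View s′
  ... | var₀       | var₀        = mk⇔ (λ _ → refl) (λ _ → tt)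
  ... | var₀       | weakened u  rewrite evalT-weaken ρ y u = image-unique k ky
  ... | weakened u | var₀        rewrite evalT-weaken ρ y u =
    ⇔.trans (image-unique k ky) (mk⇔ sym sym)
  ... | weakened u | weakened u′ rewrite evalT-weaken ρ y u | evalT-weaken ρ y u′ = ⇔.refl

  -- The atom with y := a point u avoiding all candidates: every atom relating
  -- y to another term is then false, and only R(y,y) depends on u.
  generic : ∀ {m} → U → Atom U I (suc m) → F m
  generic u (rel j s s′) with var₀View s | var₀View s′
  ... | var₀       | var₀        = rel j (const u) (const u)
  ... | var₀       | weakened _  = ff
  ... | weakened _ | var₀        = ff
  ... | weakened w | weakened w′ = rel j w w′
  generic u (eq s s′) with var₀View s | var₀View s′
  ... | var₀       | var₀        = tt
  ... | var₀       | weakened _  = ff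
  ... | weakened _ | var₀        = ff
  ... | weakened w | weakened w′ = eq w w′

  generic-qf : ∀ {m} u (a : Atom U I (suc m)) → IsQF (generic u a)
  generic-qf u (rel j s s′) with var₀View s | var₀View s′
  ... | var₀       | var₀        = rel _ _ _
  ... | var₀       | weakened _  = ff
  ... | weakened _ | var₀        = ff
  ... | weakened w | weakened w′ = rel _ _ _
  generic-qf u (eq s s′) with var₀View s | var₀View s′
  ... | var₀       | var₀        = tt
  ... | var₀       | weakened _  = ff
  ... | weakened _ | var₀        = ff
  ... | weakened w | weakened w′ = eq _ _

  data Candidate (m : ℕ) : Set where
    term  : T m → Candidate m
    image : I → T m → Candidate m

  ValueOf : ∀ {m} → (Fin m → U) → Candidate m → U → Set
  ValueOf ρ (term t)    y = y ≡ evalT ρ t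
  ValueOf ρ (image k t) y = Rel k (evalT ρ t) y

  candidates : ∀ {m} → Atom U I (suc m) → List (Candidate m)
  candidates (rel j s s′) with var₀View s | var₀View s′
  ... | var₀       | var₀        = []
  ... | var₀       | weakened u  = image (j ⁻¹) u ∷ []
  ... | weakened u | var₀        = image j u ∷ []
  ... | weakened _ | weakened _  = []
  candidates (eq s s′) with var₀View s | var₀View s′
  ... | var₀       | var₀        = []
  ... | var₀       | weakened u  = term u ∷ []
  ... | weakened u | var₀        = term u ∷ []
  ... | weakened _ | weakened _  = []

  relSymbols : ∀ {m} → Atom U I m → List I
  relSymbols (rel j _ _) = j ∷ []
  relSymbols (eq _ _)    = []

  Avoids : ∀ {m} → (Fin m → U) → U → List (Candidate m) → Set
  Avoids ρ u = All (λ c → ¬ ValueOf ρ c u)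

  open Profiles (λ j u → Rel j u u) renaming (SameProfile to SameDiagonal)

  generic-sound : ∀ {m} (ρ : Fin m → U) u (a : Atom U I (suc m)) →
    Avoids ρ u (candidates a) → ρ ⊨ generic u a ⇔ extend ρ u ⊨ atomFormula a
  generic-sound ρ u (rel j s s′) avoids with var₀View s | var₀View s′
  ... | var₀       | var₀        = ⇔.refl
  ... | var₀       | weakened w  rewrite evalT-weaken ρ u w =
    mk⇔ ⊥-elim (λ juw → All.head avoids (from (inverse-spec j _ _) juw))
  ... | weakened w | var₀        rewrite evalT-weaken ρ u w = mk⇔ ⊥-elim (All.head avoids)
  ... | weakened w | weakened w′ rewrite evalT-weaken ρ u w | evalT-weaken ρ u w′ = ⇔.refl
  generic-sound ρ u (eq s s′) avoids with var₀View s | var₀View s′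
  ... | var₀       | var₀        = mk⇔ (λ _ → refl) (λ _ → tt)
  ... | var₀       | weakened w  rewrite evalT-weaken ρ u w = mk⇔ ⊥-elim (All.head avoids)
  ... | weakened w | var₀        rewrite evalT-weaken ρ u w = mk⇔ ⊥-elim (All.head avoids ∘ sym)
  ... | weakened w | weakened w′ rewrite evalT-weaken ρ u w | evalT-weaken ρ u w′ = ⇔.refl

  generic-sameDiagonal : ∀ {m} (ρ : Fin m → U) {u r} (a : Atom U I (suc m)) →
    SameDiagonal (relSymbols a) u r → ρ ⊨ generic u a ⇔ ρ ⊨ generic r a
  generic-sameDiagonal ρ (rel j s s′) u~r with var₀View s | var₀View s′
  ... | var₀       | var₀        = All.head u~r
  ... | var₀       | weakened _  = ⇔.refl
  ... | weakened _ | var₀        = ⇔.refl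
  ... | weakened _ | weakened _  = ⇔.refl
  generic-sameDiagonal ρ (eq s s′) u~r with var₀View s | var₀View s′
  ... | var₀       | var₀        = ⇔.refl
  ... | var₀       | weakened _  = ⇔.refl
  ... | weakened _ | var₀        = ⇔.refl
  ... | weakened _ | weakened _  = ⇔.refl

  module Elimination {n : ℕ} {B : F (suc n)} (qB : IsQF B) where

    cs : List (Candidate n)
    cs = concatMap candidates (atoms qB)

    js : List I
    js = concatMap relSymbols (atoms qB)

    Witnessed : (Fin n → U) → Set
    Witnessed ρ = ∃ λ y → extend ρ y ⊨ B

    at : Candidate n → F n
    at (term t)    = replaceAtoms (atomFormula ∘ instantiateAtom t) qB
    at (image k t) = rel (k ⁻¹ ∙ k) t t ∧f replaceAtoms (viaImage k t) qB

    at-qf : ∀ c → IsQF (at c)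
    at-qf (term t)    = replaceAtoms-qf (atomFormula-qf ∘ instantiateAtom t) qB
    at-qf (image k t) = rel _ _ _ ∧f replaceAtoms-qf (viaImage-qf k t) qB

    at-sound : ∀ ρ c → ρ ⊨ at c ⇔ ∃ λ y → ValueOf ρ c y × extend ρ y ⊨ B
    at-sound ρ (term t) = mk⇔ (λ x → evalT ρ t , refl , to B-at-t x) (λ { (_ , refl , x) → from B-at-t x })
      where
      B-at-t : ρ ⊨ at (term t) ⇔ extend ρ (evalT ρ t) ⊨ B
      B-at-t = replaceAtoms-sound Rel qB (All.universal (instantiateAtom-sound Rel ρ t) (atoms qB))
    at-sound ρ (image k t) = mk⇔ forward backward
      where
      B-at : ∀ {y} → Rel k (evalT ρ t) y → ρ ⊨ replaceAtoms (viaImage k t) qB ⇔ extend ρ y ⊨ B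
      B-at ky = replaceAtoms-sound Rel qB (All.universal (viaImage-sound ρ k t ky) (atoms qB))
      forward : ρ ⊨ at (image k t) → ∃ λ y → ValueOf ρ (image k t) y × extend ρ y ⊨ B
      forward (inDomain , x) with to (domain-spec k (evalT ρ t)) inDomain
      ... | y , ky = y , ky , to (B-at ky) x
      backward : (∃ λ y → ValueOf ρ (image k t) y × extend ρ y ⊨ B) → ρ ⊨ at (image k t)
      backward (y , ky , x) = from (domain-spec k (evalT ρ t)) (y , ky) , from (B-at ky) x

    genericB : U → F n
    genericB u = replaceAtoms (generic u) qB

    genericB-sound : ∀ ρ u → Avoids ρ u cs → ρ ⊨ genericB u ⇔ extend ρ u ⊨ B
    genericB-sound ρ u avoids = replaceAtoms-sound Rel qB
      (All.map (λ {a} → generic-sound ρ u a) (Allₚ.map⁻ (Allₚ.concat⁻ avoids)))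

    genericB-sameDiagonal : ∀ ρ {u r} → SameDiagonal js u r → ρ ⊨ genericB u ⇔ ρ ⊨ genericB r
    genericB-sameDiagonal ρ u~r = replaceAtoms-cong Rel qB
      (All.map (λ {a} → generic-sameDiagonal ρ a) (Allₚ.map⁻ (Allₚ.concat⁻ u~r)))

    -- A covered class is finite: freezing the candidates at ρ₀ names each of
    -- its points by a constant.
    freeze : (Fin n → U) → Candidate n → Candidate n
    freeze ρ₀ (term t)    = term (const (evalT ρ₀ t))
    freeze ρ₀ (image k t) = image k (const (evalT ρ₀ t))

    freeze-value : ∀ ρ₀ {ρ y} c → ValueOf ρ₀ c y → ValueOf ρ (freeze ρ₀ c) y
    freeze-value ρ₀ (term t)    y≡t = y≡t
    freeze-value ρ₀ (image k t) kty = kty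

    Covered : U → Set
    Covered r = ∃ λ ρ₀ → ∀ u → SameDiagonal js u r → Any (λ c → ValueOf ρ₀ c u) cs

    Escapes : U → Set
    Escapes r = ∀ ρ → ∃ λ u → SameDiagonal js u r × Avoids ρ u cs

    covered-or-escapes : ∀ r → Covered r ⊎ Escapes r
    covered-or-escapes r with em {Covered r}
    ... | yes covered = inj₁ covered
    ... | no ¬covered = inj₂ λ ρ → em⇒dne em λ ¬escape →
      ¬covered (ρ , λ u u~r → em⇒dne em λ ¬hit → ¬escape (u , u~r , Allₚ.¬Any⇒All¬ cs ¬hit))

    disjunctsFor : ∀ r → Covered r ⊎ Escapes r → List (F n)
    disjunctsFor r (inj₁ (ρ₀ , _)) = map (at ∘ freeze ρ₀) cs
    disjunctsFor r (inj₂ _)        = genericB r ∷ []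

    disjunctsFor-qf : ∀ r d → All IsQF (disjunctsFor r d)
    disjunctsFor-qf r (inj₁ (ρ₀ , _)) = Allₚ.map⁺ (All.universal (at-qf ∘ freeze ρ₀) cs)
    disjunctsFor-qf r (inj₂ _)        = replaceAtoms-qf (generic-qf r) qB ∷ []

    disjunctsAt : U → List (F n)
    disjunctsAt r = disjunctsFor r (covered-or-escapes r)

    reps : List U
    reps = proj₁ (representatives js)

    disjuncts : List (F n)
    disjuncts = map at cs ++ concatMap disjunctsAt reps

    eliminated : F n
    eliminated = ⋁ Rel disjuncts

    eliminated-qf : IsQF eliminated
    eliminated-qf = ⋁-qf Rel (Allₚ.++⁺ (Allₚ.map⁺ (All.universal at-qf cs))
      (Allₚ.concat⁺ (Allₚ.map⁺ (All.universal (λ r → disjunctsFor-qf r (covered-or-escapes r)) reps))))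

    module _ (ρ : Fin n → U) where

      at-witnessed : ∀ c → ρ ⊨ at c → Witnessed ρ
      at-witnessed c x with to (at-sound ρ c) x
      ... | y , _ , By = y , By

      disjunctsFor-witnessed : ∀ r d → Any (ρ ⊨_) (disjunctsFor r d) → Witnessed ρ
      disjunctsFor-witnessed r (inj₁ (ρ₀ , _)) x with Any.satisfied (Anyₚ.map⁻ x)
      ... | c , x′ = at-witnessed (freeze ρ₀ c) x′
      disjunctsFor-witnessed r (inj₂ escapes) (here x) with escapes ρ
      ... | u , u~r , avoids =
        u , to (genericB-sound ρ u avoids) (from (genericB-sameDiagonal ρ u~r) x)

      disjuncts-witnessed : Any (ρ ⊨_) disjuncts → Witnessed ρ
      disjuncts-witnessed x with Anyₚ.++⁻ (map at cs) x
      ... | inj₁ x′ with Any.satisfied (Anyₚ.map⁻ x′)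
      ...   | c , x″ = at-witnessed c x″
      disjuncts-witnessed x | inj₂ x′ with Any.satisfied (Anyₚ.concatMap⁻ disjunctsAt {xs = reps} x′)
      ...   | r , x″ = disjunctsFor-witnessed r (covered-or-escapes r) x″

      module _ {y : U} (By : extend ρ y ⊨ B) where

        at-complete : ∀ c → ValueOf ρ c y → ρ ⊨ at c
        at-complete c yc = from (at-sound ρ c) (y , yc , By)

        disjunctsFor-complete : Avoids ρ y cs → ∀ r d → SameDiagonal js y r →
          Any (ρ ⊨_) (disjunctsFor r d)
        disjunctsFor-complete _ r (inj₁ (ρ₀ , cover)) y~r =
          Anyₚ.map⁺ (Any.map (λ {c} → at-complete (freeze ρ₀ c) ∘ freeze-value ρ₀ c) (cover y y~r))
        disjunctsFor-complete avoids r (inj₂ _) y~r =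
          here (to (genericB-sameDiagonal ρ y~r) (from (genericB-sound ρ y avoids) By))

        disjuncts-complete : Any (ρ ⊨_) disjuncts
        disjuncts-complete with em {Any (λ c → ValueOf ρ c y) cs}
        ... | yes hit = Anyₚ.++⁺ˡ (Anyₚ.map⁺ (Any.map (λ {c} → at-complete c) hit))
        ... | no ¬hit = Anyₚ.++⁺ʳ (map at cs) (Anyₚ.concatMap⁺ disjunctsAt (Any.map
              (λ {r} → disjunctsFor-complete (Allₚ.¬Any⇒All¬ cs ¬hit) r (covered-or-escapes r))
              (proj₂ (representatives js) y)))

      eliminated-sound : ρ ⊨ eliminated ⇔ Witnessed ρ
      eliminated-sound = ⇔.trans (⋁-sound Rel ρ disjuncts)
        (mk⇔ disjuncts-witnessed (λ (_ , By) → disjuncts-complete By))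

  QFEquivalent : ∀ {n} → F n → Set
  QFEquivalent {n} A = Σ (F n) λ B → IsQF B × ((ρ : Fin n → U) → ρ ⊨ A ⇔ ρ ⊨ B)

  eliminate-∃ : ∀ {n} {A : F (suc n)} → QFEquivalent A → QFEquivalent (∃f A)
  eliminate-∃ (B , qB , A⇔B) = eliminated , eliminated-qf ,
    λ ρ → ⇔.trans (Σ-⇔ (↠-id _) (A⇔B _)) (⇔.sym (eliminated-sound ρ))
    where open Elimination qB

  eliminate-∀ : ∀ {n} {A : F (suc n)} → QFEquivalent A → QFEquivalent (∀f A)
  eliminate-∀ (B , qB , A⇔B) with eliminate-∃ {A = ¬f B} (¬f B , ¬f qB , λ ρ → ⇔.refl)
  ... | C , qC , ∃¬B⇔C = ¬f C , ¬f qC ,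
    λ ρ → ⇔.trans (mk⇔ (λ ∀A u → to (A⇔B _) (∀A u)) (λ ∀B u → from (A⇔B _) (∀B u)))
            (⇔.trans ∀⇔¬∃¬ (¬-cong-⇔ (∃¬B⇔C ρ)))

  quantifierElimination : ∀ {n} (A : F n) → QFEquivalent A
  quantifierElimination (rel i s t) = rel i s t , rel i s t , λ ρ → ⇔.refl
  quantifierElimination (eq s t)    = eq s t , eq s t , λ ρ → ⇔.refl
  quantifierElimination tt          = tt , tt , λ ρ → ⇔.refl
  quantifierElimination ff          = ff , ff , λ ρ → ⇔.refl
  quantifierElimination (¬f A) with quantifierElimination A
  ... | B , qB , e = ¬f B , ¬f qB , λ ρ → ¬-cong-⇔ (e ρ)
  quantifierElimination (A ∧f A′) with quantifierElimination A | quantifierElimination A′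
  ... | B , qB , e | B′ , qB′ , e′ = B ∧f B′ , qB ∧f qB′ , λ ρ → e ρ ×-⇔ e′ ρ
  quantifierElimination (A ∨f A′) with quantifierElimination A | quantifierElimination A′
  ... | B , qB , e | B′ , qB′ , e′ = B ∨f B′ , qB ∨f qB′ , λ ρ → e ρ ⊎-⇔ e′ ρ
  quantifierElimination (A ⇒f A′) with quantifierElimination A | quantifierElimination A′
  ... | B , qB , e | B′ , qB′ , e′ = B ⇒f B′ , qB ⇒f qB′ , λ ρ → →-cong-⇔ (e ρ) (e′ ρ)
  quantifierElimination (∀f A) = eliminate-∀ {A = A} (quantifierElimination A)
  quantifierElimination (∃f A) = eliminate-∃ {A = A} (quantifierElimination A)

theorem7p3 : ExcludedMiddle 0ℓ →
    (U I : Set) (Rel : I → BinRel U) →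
    (∀ i → IsPartialBijection (Rel i)) →
    ClosedInvComp Rel →
    ∀ {n : ℕ} (A : Formula U I n) →
    Σ (Formula U I n) λ B → IsQF B ×
    ((ρ : Fin n → U) → Sat Rel ρ A ⇔ Sat Rel ρ B)
theorem7p3 em U I Rel isPB closed = QuantifierElimination.quantifierElimination em Rel isPB closed
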